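{- Let $\vec x=x_1,\dots,x_\ell$ and $\vec X=X_1,\dots,X_p$, let $\psi$ be a formula with free variables among $\vec x,\vec X,Y$, and let $\hat\varphi$ be a formula with free variables among $y,\vec X$ which is uniformly bounded by $y$. Then there is a finite-state synchronous function $F:\{0,1\}^\ell\times\{0,1\}^p\times\mathbf 1^\ell\times M(\psi[\hat\varphi[y]/Y])\to M(\exists Y\psi)$, effectively computable from $\psi$ and $\hat\varphi$, such that $\psi[\hat\varphi[y]/Y]\Vdash_{\vec x,\vec X}F:\exists Y\psi$; i.e. for all $\vec k\in\mathbb N^\ell$, all $\vec\sigma\in(\{0,1\}^\omega)^p$ and all $R\Vdash\mathcal I[\psi[\hat\varphi[y]/Y]](\vec k,\vec\sigma)$, we have $F(\vec k,\vec\sigma,\vec\ast,R)\Vdash\mathcal I[\exists Y\psi](\vec k,\vec\sigma)$.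
   Context: \emph{Formulae.} Two-sorted language; atoms $x\doteq y$, $x\leq y$, $\mathsf S(x,y)$, $\mathsf{Zero}(x)$, $x\in X$, $\top,\bot$; formulae $\varphi::=\alpha\mid\varphi\wedge\psi\mid\lnot\varphi\mid\exists x\varphi\mid\exists X\varphi$. $\psi[\hat\varphi[y]/Y]$ replaces each atom $t\in Y$ by $\hat\varphi[t/y]$. Relativization: $\alpha|\theta[u]:=\alpha$, commuting with $\wedge,\lnot,\exists X$, and $(\exists x\chi)|\theta[u]:=\exists x(\theta[x/u]\wedge\chi|\theta[u])$; a formula is uniformly bounded by $y$ if it has the form $\chi|(u\leq y)[u]$ and $y$ is its only free individual variable. Standard model $\mathfrak N$ (individuals $\mathbb N$, predicates subsets of $\mathbb N\cong\{0,1\}^\omega$). A natural number $k$ is identified with the stream which is $1$ exactly at position $k$; $\mathbf 1=\{\ast\}$; tuples of streams are identified with streams over product alphabets; finite-state synchronous functions are those induced by deterministic Mealy machines. \emph{Uniform automata and interpretation.} A uniform automaton over $\Sigma$ is $(Q,q_0,M,\partial,\Omega)$ with $\partial:Q\times\Sigma\times M\to Q$, $M$ a finite nonempty set of moves, $\Omega$ $\omega$-regular; $R\in M^\omega$ is an accepting run on $\sigma$ ($R\Vdash\mathcal A(\sigma)$) if the induced state sequence is in $\Omega$. For $\varphi$ with free variables among $\vec x,\vec X$, $\mathcal I[\varphi]$ is a uniform automaton over $\{0,1\}^\ell\times\{0,1\}^p$ with moves $M(\varphi)$: atoms get deterministic automata (moves $\mathbf 1$) accepting, on singleton individual inputs,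 exactly the true instances; $\mathcal I[\lnot\psi]$ is deterministic (moves $\mathbf 1$) recognizing the complement of $\mathcal L(\mathcal I[\psi])$; $\mathcal I[\psi_1\wedge\psi_2]$ has moves $M(\psi_1)\times M(\psi_2)$ and a pair of runs is accepting iff both are; $\mathcal I[\exists X\psi]$ has moves $\{0,1\}\times M(\psi)$ and $(\beta,R)$ is accepting on $(\vec k,\vec\sigma)$ iff $R\Vdash\mathcal I[\psi]_{\vec x,\vec X,X}(\vec k,\vec\sigma,\beta)$; $\mathcal I[\exists x\psi]$ has moves $\{0,1\}\times(\mathbf 1\times M(\psi))$ and $(\beta,(\ast,R))$ is accepting on $(\vec k,\vec\sigma)$ iff $\beta$ is a singleton stream $k$ and $R\Vdash\mathcal I[\psi]_{\vec x,x,\vec X}(\vec k,k,\vec\sigma)$. -}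

module Defs where

open import Data.Nat using (ℕ; zero; suc; _≤_; _≡ᵇ_)
open import Data.Fin using (Fin; zero; suc)
open import Data.Bool using (Bool; true)
open import Data.Maybe using (Maybe; just; nothing)
open import Data.Unit using (⊤; tt)
open import Data.Empty using (⊥)
open import Data.Product using (Σ; _×_; _,_; proj₁; proj₂)
open import Relation.Binary.PropositionalEquality using (_≡_)
open import Relation.Nullary using (¬_)

Stream : Set → Set
Stream A = ℕ → A

_∷ᵥ_ : ∀ {n} {A : Set} → A → (Fin n → A) → (Fin (suc n) → A)
(a ∷ᵥ f) zero = a
(a ∷ᵥ f) (suc i) = f i

-- Two-sorted formulae, well scoped: Formula n q has its free individual
-- variables among Fin n and its free set variables among Fin q.
-- Binders introduce the new variable as index zero.

data Formula (n q : ℕ) : Set where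
  _≐_  : Fin n → Fin n → Formula n q
  _≼_  : Fin n → Fin n → Formula n q
  𝐒    : Fin n → Fin n → Formula n q
  𝐙    : Fin n → Formula n q
  _∈ᶠ_ : Fin n → Fin q → Formula n q
  𝐓 𝐅  : Formula n q
  _∧ᶠ_ : Formula n q → Formula n q → Formula n q
  ¬ᶠ_  : Formula n q → Formula n q
  ∃ᵢ_  : Formula (suc n) q → Formula n q
  ∃ₛ_  : Formula n (suc q) → Formula n q

liftᵣ : ∀ {m n} → (Fin m → Fin n) → Fin (suc m) → Fin (suc n)
liftᵣ ρ zero = zero
liftᵣ ρ (suc i) = suc (ρ i)

renI : ∀ {m n q} → (Fin m → Fin n) → Formula m q → Formula n q
renI ρ (x ≐ y) = ρ x ≐ ρ y
renI ρ (x ≼ y) = ρ x ≼ ρ y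
renI ρ (𝐒 x y) = 𝐒 (ρ x) (ρ y)
renI ρ (𝐙 x) = 𝐙 (ρ x)
renI ρ (x ∈ᶠ X) = ρ x ∈ᶠ X
renI ρ 𝐓 = 𝐓
renI ρ 𝐅 = 𝐅
renI ρ (φ ∧ᶠ ψ) = renI ρ φ ∧ᶠ renI ρ ψ
renI ρ (¬ᶠ φ) = ¬ᶠ renI ρ φ
renI ρ (∃ᵢ φ) = ∃ᵢ renI (liftᵣ ρ) φ
renI ρ (∃ₛ φ) = ∃ₛ renI ρ φ

renS : ∀ {n q r} → (Fin q → Fin r) → Formula n q → Formula n r
renS ρ (x ≐ y) = x ≐ y
renS ρ (x ≼ y) = x ≼ y
renS ρ (𝐒 x y) = 𝐒 x y
renS ρ (𝐙 x) = 𝐙 x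
renS ρ (x ∈ᶠ X) = x ∈ᶠ ρ X
renS ρ 𝐓 = 𝐓
renS ρ 𝐅 = 𝐅
renS ρ (φ ∧ᶠ ψ) = renS ρ φ ∧ᶠ renS ρ ψ
renS ρ (¬ᶠ φ) = ¬ᶠ renS ρ φ
renS ρ (∃ᵢ φ) = ∃ᵢ renS ρ φ
renS ρ (∃ₛ φ) = ∃ₛ renS (liftᵣ ρ) φ

-- Substitution ψ[φ̂[y]/Y]: each atom t ∈ Y is replaced by φ̂[t/y].
-- ρ maps set variables of ψ to set variables of the result, with
-- 'nothing' marking the substituted variable Y.

liftₘ : ∀ {q r} → (Fin q → Maybe (Fin r)) → Fin (suc q) → Maybe (Fin (suc r))
liftₘ ρ zero = just zero
liftₘ ρ (suc i) with ρ i
... | just j = just (suc j)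
... | nothing = nothing

substY : ∀ {n q r} → (Fin q → Maybe (Fin r)) → Formula 1 r → Formula n q → Formula n r
substY ρ φ̂ (x ≐ y) = x ≐ y
substY ρ φ̂ (x ≼ y) = x ≼ y
substY ρ φ̂ (𝐒 x y) = 𝐒 x y
substY ρ φ̂ (𝐙 x) = 𝐙 x
substY ρ φ̂ (t ∈ᶠ X) with ρ X
... | just j = t ∈ᶠ j
... | nothing = renI (λ _ → t) φ̂
substY ρ φ̂ 𝐓 = 𝐓
substY ρ φ̂ 𝐅 = 𝐅
substY ρ φ̂ (φ ∧ᶠ ψ) = substY ρ φ̂ φ ∧ᶠ substY ρ φ̂ ψ
substY ρ φ̂ (¬ᶠ φ) = ¬ᶠ substY ρ φ̂ φ
substY ρ φ̂ (∃ᵢ φ) = ∃ᵢ substY ρ φ̂ φ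
substY ρ φ̂ (∃ₛ φ) = ∃ₛ substY (liftₘ ρ) (renS suc φ̂) φ

ρY : ∀ {p} → Fin (suc p) → Maybe (Fin p)
ρY zero = nothing
ρY (suc i) = just i

-- ψ[φ̂[y]/Y], where Y is the set variable zero of ψ and y the unique
-- individual variable of φ̂
_[_/Y] : ∀ {ℓ p} → Formula ℓ (suc p) → Formula 1 p → Formula ℓ p
ψ [ φ̂ /Y] = substY ρY φ̂ ψ

rel≤ : ∀ {n q} → Fin n → Formula n q → Formula n q
rel≤ y (x ≐ z) = x ≐ z
rel≤ y (x ≼ z) = x ≼ z
rel≤ y (𝐒 x z) = 𝐒 x z
rel≤ y (𝐙 x) = 𝐙 x
rel≤ y (x ∈ᶠ X) = x ∈ᶠ X
rel≤ y 𝐓 = 𝐓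
rel≤ y 𝐅 = 𝐅
rel≤ y (φ ∧ᶠ ψ) = rel≤ y φ ∧ᶠ rel≤ y ψ
rel≤ y (¬ᶠ φ) = ¬ᶠ rel≤ y φ
rel≤ y (∃ᵢ χ) = ∃ᵢ ((zero ≼ suc y) ∧ᶠ rel≤ (suc y) χ)
rel≤ y (∃ₛ χ) = ∃ₛ rel≤ y χ

UniformlyBounded : ∀ {p} → Formula 1 p → Set
UniformlyBounded {p} φ̂ = Σ (Formula 1 p) (λ χ → φ̂ ≡ rel≤ zero χ)

M : ∀ {n q} → Formula n q → Set
M (φ ∧ᶠ ψ) = M φ × M ψ
M (¬ᶠ φ) = ⊤
M (∃ᵢ φ) = Bool × (⊤ × M φ)
M (∃ₛ φ) = Bool × M φ
M _ = ⊤

singleton : ℕ → Stream Bool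
singleton k n = n ≡ᵇ k

-- Accepts φ k⃗ σ⃗ R  means  R ⊩ 𝓘[φ](k⃗, σ⃗), for individual inputs given as
-- natural numbers k⃗ (i.e. singleton streams).  This is the acceptance
-- relation of the interpretation 𝓘[φ] unfolded along its defining clauses:
-- atoms are evaluated in the standard model 𝔑 (S(x,y) meaning y = x+1).
Accepts : ∀ {n q} → (φ : Formula n q) → (Fin n → ℕ) → (Fin q → Stream Bool) → Stream (M φ) → Set
Accepts (x ≐ y) k σ R = k x ≡ k y
Accepts (x ≼ y) k σ R = k x ≤ k y
Accepts (𝐒 x y) k σ R = k y ≡ suc (k x)
Accepts (𝐙 x) k σ R = k x ≡ 0
Accepts (x ∈ᶠ X) k σ R = σ X (k x) ≡ true
Accepts 𝐓 k σ R = ⊤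
Accepts 𝐅 k σ R = ⊥
Accepts (φ ∧ᶠ ψ) k σ R =
  Accepts φ k σ (λ t → proj₁ (R t)) × Accepts ψ k σ (λ t → proj₂ (R t))
Accepts (¬ᶠ φ) k σ R = ¬ (Σ (Stream (M φ)) (λ R′ → Accepts φ k σ R′))
Accepts (∃ₛ φ) k σ R =
  Accepts φ k ((λ t → proj₁ (R t)) ∷ᵥ σ) (λ t → proj₂ (R t))
Accepts (∃ᵢ φ) k σ R =
  Σ ℕ (λ m → (∀ t → proj₁ (R t) ≡ singleton m t)
           × Accepts φ (m ∷ᵥ k) σ (λ t → proj₂ (proj₂ (R t))))

-- Finite-state synchronous functions: induced by deterministic Mealy
-- machines with finitely many states.

record Mealy (I O : Set) : Set where
  field
    states : ℕ
    init   : Fin states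
    δ      : Fin states → I → Fin states
    out    : Fin states → I → O

module _ {I O : Set} (F : Mealy I O) where
  open Mealy F

  stateAt : Stream I → ℕ → Fin states
  stateAt w zero = init
  stateAt w (suc t) = δ (stateAt w t) (w t)

  runMealy : Stream I → Stream O
  runMealy w t = out (stateAt w t) (w t)

Input : ℕ → ℕ → Set → Set
Input ℓ p A = (Fin ℓ → Bool) × (Fin p → Bool) × (Fin ℓ → ⊤) × A

inputStream : ∀ {ℓ p} {A : Set} → (Fin ℓ → ℕ) → (Fin p → Stream Bool) → Stream A → Stream (Input ℓ p A)
inputStream k σ R t = (λ i → singleton (k i) t) , (λ j → σ j t) , (λ _ → tt) , R t

-- Bounded formulae are recognised by deterministic automata on finite words
-- (products for ∧, complementation for ¬, the subset construction for ∃,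
-- plus an automaton checking that a guessed bit marks exactly one position for
-- individual ∃).  As φ̂ = χ|(u ≤ y) only looks at positions ≤ y, whether φ̂[t]
-- holds is decided by the automaton of χ after reading σ⃗ up to position t with
-- y marked at t.  A Mealy machine running that automaton on σ⃗ therefore outputs,
-- at time t, the truth value of φ̂[t]: this stream is a witness for Y in ∃Y ψ,
-- and the moves of ψ[φ̂[y]/Y] translate to moves of ψ along the substitution.

module Submission where

open import Defs
open import Data.Bool using (Bool; true; false; not; _∧_; _∨_; if_then_else_; T)
open import Data.Bool.Properties using (T-∧; T-≡; T-not-≡)
open import Data.Empty using (⊥; ⊥-elim)
open import Data.Fin using (Fin; zero; suc; _≟_; finToFun; funToFin)
open import Data.Fin.Properties using (*↔×; 2↔Bool; any?; finToFun-funToFin)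
open import Data.Nat using (ℕ; zero; suc; _≤_; _<_; _<ᵇ_; _*_; _^_; s≤s; s≤s⁻¹) renaming (_≟_ to _≟ℕ_)
open import Data.Nat.Properties
  using ( ≡ᵇ⇒≡; ≡⇒≡ᵇ; <ᵇ⇒<; <⇒<ᵇ; ≤-refl; <⇒≤; <⇒≢; >⇒≢; m<1+n⇒m<n∨m≡n; m≤n⇒m≤1+n
        ; suc-injective; ≮⇒≥; ≤⇒≯)
open import Data.Product using (Σ; ∃; ∃-syntax; _×_; _,_; proj₁; proj₂)
open import Data.Product.Function.NonDependent.Propositional using (_×-⇔_; _×-↔_)
open import Data.Sum using (_⊎_; inj₁; inj₂)
open import Data.Maybe using (Maybe; just; nothing)
open import Data.Unit using (⊤; tt)
open import Function using (_∘_; const; id)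
open import Function.Bundles using (_⇔_; mk⇔; Equivalence; _↔_; Inverse)
import Function.Properties.Equivalence as ⇔
open import Function.Properties.Inverse using (↔-trans)
open import Function.Related.TypeIsomorphisms using (¬-cong-⇔)
open import Relation.Binary.PropositionalEquality using (_≡_; _≢_; refl; sym; trans; cong; cong₂; subst)
open import Relation.Nullary using (¬_; Dec; yes; no; does)
open import Relation.Nullary.Decidable using (T?; map′; _×-dec_; _⊎-dec_)

open Equivalence using (to; from)

≡⇒T⇔ : ∀ {b c} → b ≡ c → T b ⇔ T c
≡⇒T⇔ refl = ⇔.refl

T-not : ∀ {b} → T (not b) ⇔ (¬ T b)
T-not {true} = mk⇔ (λ ()) (λ ¬t → ¬t tt)
T-not {false} = mk⇔ (λ _ ()) (const tt)

T-does : ∀ {A : Set} (a? : Dec A) → T (does a?) ⇔ A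
T-does (yes a) = mk⇔ (const a) (const tt)
T-does (no ¬a) = mk⇔ (λ ()) ¬a

∃-⇔ : ∀ {X : Set} {A B : X → Set} → (∀ x → A x ⇔ B x) → ∃ A ⇔ ∃ B
∃-⇔ A⇔B = mk⇔ (λ (x , a) → x , to (A⇔B x) a) (λ (x , b) → x , from (A⇔B x) b)

T-singleton : ∀ {m t} → T (singleton m t) ⇔ t ≡ m
T-singleton {m} {t} = mk⇔ (≡ᵇ⇒≡ t m) (≡⇒≡ᵇ t m)

singleton-refl : ∀ m → singleton m m ≡ true
singleton-refl m = to T-≡ (from (T-singleton {m} {m}) refl)

singleton-≢ : ∀ {m t} → t ≢ m → singleton m t ≡ false
singleton-≢ t≢m = to T-not-≡ (from T-not (t≢m ∘ to T-singleton))

T-not-<ᵇ : ∀ {m n} → T (not (m <ᵇ n)) ⇔ n ≤ m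
T-not-<ᵇ {m} {n} = ⇔.trans T-not (mk⇔ (λ m≮n → ≮⇒≥ (m≮n ∘ <⇒<ᵇ)) (λ n≤m → ≤⇒≯ n≤m ∘ <ᵇ⇒< m n))

<ᵇ-suc : ∀ m t → (m <ᵇ t) ∨ singleton m t ≡ (m <ᵇ suc t)
<ᵇ-suc zero zero = refl
<ᵇ-suc zero (suc t) = refl
<ᵇ-suc (suc m) zero = refl
<ᵇ-suc (suc m) (suc t) = <ᵇ-suc m t

<-suc-elim : ∀ {P : ℕ → Set} {t} → (∀ u → u < t → P u) → P t → ∀ u → u < suc t → P u
<-suc-elim below at u u<1+t with m<1+n⇒m<n∨m≡n u<1+t
... | inj₁ u<t = below u u<t
... | inj₂ refl = at

-- Deterministic automata on finite words

runFrom : ∀ {S I : Set} → (S → I → S) → S → Stream I → ℕ → S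
runFrom δ s w zero = s
runFrom δ s w (suc t) = δ (runFrom δ s w t) (w t)

runFrom-prefix : ∀ {S I : Set} (δ : S → I → S) s {w w′ : Stream I} t →
  (∀ u → u < t → w u ≡ w′ u) → runFrom δ s w t ≡ runFrom δ s w′ t
runFrom-prefix δ s zero agree = refl
runFrom-prefix δ s (suc t) agree =
  cong₂ δ (runFrom-prefix δ s t (λ u u<t → agree u (m≤n⇒m≤1+n u<t))) (agree t ≤-refl)

runFrom-× : ∀ {S S′ I : Set} (δ : S → I → S) (δ′ : S′ → I → S′) s s′ w t →
  runFrom (λ (r , r′) a → δ r a , δ′ r′ a) (s , s′) w t ≡ (runFrom δ s w t , runFrom δ′ s′ w t)
runFrom-× δ δ′ s s′ w zero = refl
runFrom-× δ δ′ s s′ w (suc t) rewrite runFrom-× δ δ′ s s′ w t = refl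

record DFA (I : Set) : Set where
  field
    size      : ℕ
    start     : Fin size
    step      : Fin size → I → Fin size
    accepting : Fin size → Bool

module _ {I : Set} (D : DFA I) where
  open DFA D

  run : Stream I → ℕ → Fin size
  run = runFrom step start

  accepts : Stream I → ℕ → Bool
  accepts w L = accepting (run w L)

module _ {S I : Set} {n : ℕ} (code : Fin n ↔ S) (s₀ : S) (δ : S → I → S) (final : S → Bool) where
  open Inverse code renaming (to to decode; from to encode)

  encodedDFA : DFA I
  encodedDFA = record
    { size = n
    ; start = encode s₀
    ; step = λ i a → encode (δ (decode i) a)
    ; accepting = final ∘ decode
    }

  decode-run : ∀ w t → decode (run encodedDFA w t) ≡ runFrom δ s₀ w t
  decode-run w zero = strictlyInverseˡ s₀
  decode-run w (suc t) = trans (strictlyInverseˡ _) (cong (λ s → δ s (w t)) (decode-run w t))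

  accepts-encodedDFA : ∀ w L → accepts encodedDFA w L ≡ final (runFrom δ s₀ w L)
  accepts-encodedDFA w L = cong final (decode-run w L)

complement : ∀ {I} → DFA I → DFA I
complement D = record D { accepting = not ∘ DFA.accepting D }

constant : ∀ {I} → Bool → DFA I
constant b = record { size = 1 ; start = zero ; step = λ s _ → s ; accepting = const b }

module _ {I : Set} (D E : DFA I) where
  private
    module D = DFA D
    module E = DFA E

    bothStep : Fin D.size × Fin E.size → I → Fin D.size × Fin E.size
    bothStep (s , s′) a = D.step s a , E.step s′ a

    bothAccept : Fin D.size × Fin E.size → Bool
    bothAccept (s , s′) = D.accepting s ∧ E.accepting s′

  _⊗_ : DFA I
  _⊗_ = encodedDFA *↔× (D.start , E.start) bothStep bothAccept

  accepts-⊗ : ∀ w L → accepts _⊗_ w L ≡ accepts D w L ∧ accepts E w L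
  accepts-⊗ w L = trans (accepts-encodedDFA *↔× _ bothStep bothAccept w L)
                        (cong bothAccept (runFrom-× D.step E.step D.start E.start w L))

memory : ∀ {I : Set} → (Bool → I → Bool) → Stream I → ℕ → Bool
memory update = runFrom update false

module _ {I : Set} (update check : Bool → I → Bool) (final : Bool → Bool) where
  private
    monitorStep : Bool × Bool → I → Bool × Bool
    monitorStep (m , ok) a = update m a , ok ∧ check m a

    monitorAccept : Bool × Bool → Bool
    monitorAccept (m , ok) = ok ∧ final m

    bitPairs : Fin (2 * 2) ↔ (Bool × Bool)
    bitPairs = ↔-trans *↔× (2↔Bool ×-↔ 2↔Bool)

    passed : Stream I → ℕ → Bool
    passed w zero = true
    passed w (suc t) = passed w t ∧ check (memory update w t) (w t)

    monitor-state : ∀ w t → runFrom monitorStep (false , true) w t ≡ (memory update w t , passed w t)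
    monitor-state w zero = refl
    monitor-state w (suc t) rewrite monitor-state w t = refl

    T-passed : ∀ w t → T (passed w t) ⇔ (∀ u → u < t → T (check (memory update w u) (w u)))
    T-passed w zero = mk⇔ (λ _ _ ()) (const tt)
    T-passed w (suc t) = ⇔.trans T-∧ (mk⇔
      (λ (below , now) → <-suc-elim (to (T-passed w t) below) now)
      (λ all → from (T-passed w t) (λ u u<t → all u (m≤n⇒m≤1+n u<t)) , all t ≤-refl))

  monitor : DFA I
  monitor = encodedDFA bitPairs (false , true) monitorStep monitorAccept

  accepts-monitor : ∀ w L → T (accepts monitor w L) ⇔
    ((∀ t → t < L → T (check (memory update w t) (w t))) × T (final (memory update w L)))
  accepts-monitor w L =
    ⇔.trans (≡⇒T⇔ (trans (accepts-encodedDFA bitPairs (false , true) monitorStep monitorAccept w L)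
                          (cong monitorAccept (monitor-state w L))))
            (⇔.trans T-∧ (T-passed w L ×-⇔ ⇔.refl))

SingletonBelow : ℕ → Stream Bool → ℕ → Set
SingletonBelow L g m = ∀ t → t < L → g t ≡ singleton m t

seen : ∀ {I : Set} → (I → Bool) → Bool → I → Bool
seen mark m a = m ∨ mark a

memory-seen : ∀ {I : Set} (mark : I → Bool) (w : Stream I) {L m} →
  SingletonBelow L (mark ∘ w) m → ∀ t → t ≤ L → memory (seen mark) w t ≡ (m <ᵇ t)
memory-seen mark w marks zero _ = refl
memory-seen mark w {m = m} marks (suc t) t<L =
  trans (cong₂ _∨_ (memory-seen mark w marks t (<⇒≤ t<L)) (marks t t<L)) (<ᵇ-suc m t)

module _ {I : Set} (mark : I → Bool) where
  private
    notMarkedAgain : Bool → I → Bool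
    notMarkedAgain m a = not (m ∧ mark a)

  exactlyOneMark : DFA I
  exactlyOneMark = monitor (seen mark) notMarkedAgain id

  private
    OneMarkBelow : Stream I → ℕ → Set
    OneMarkBelow w t =
      (memory (seen mark) w t ≡ false × (∀ u → u < t → mark (w u) ≡ false)) ⊎
      (∃[ m ] m < t × memory (seen mark) w t ≡ true × SingletonBelow t (mark ∘ w) m)

    oneMarkBelow : ∀ w t → (∀ u → u < t → T (notMarkedAgain (memory (seen mark) w u) (w u))) →
      OneMarkBelow w t
    oneMarkBelow w zero _ = inj₁ (refl , λ _ ())
    oneMarkBelow w (suc t) ok with oneMarkBelow w t (λ u u<t → ok u (m≤n⇒m≤1+n u<t))
    ... | inj₁ (mem , none) = markAt (mark (w t)) refl
      where
      markAt : ∀ b → mark (w t) ≡ b → OneMarkBelow w (suc t)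
      markAt false eq = inj₁ (cong₂ _∨_ mem eq , <-suc-elim none eq)
      markAt true eq = inj₂ (t , ≤-refl , cong₂ _∨_ mem eq ,
        <-suc-elim (λ u u<t → trans (none u u<t) (sym (singleton-≢ (<⇒≢ u<t))))
                   (trans eq (sym (singleton-refl t))))
    oneMarkBelow w (suc t) ok | inj₂ (m , m<t , mem , marks) =
      inj₂ (m , m≤n⇒m≤1+n m<t , cong (_∨ mark (w t)) mem ,
            <-suc-elim marks (trans unmarked (sym (singleton-≢ (>⇒≢ m<t)))))
      where
      unmarked : mark (w t) ≡ false
      unmarked = to T-not-≡ (subst (λ b → T (not (b ∧ mark (w t)))) mem (ok t ≤-refl))

    no-second-mark : ∀ m t → T (not ((m <ᵇ t) ∧ singleton m t))
    no-second-mark zero zero = tt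
    no-second-mark zero (suc t) = tt
    no-second-mark (suc m) zero = tt
    no-second-mark (suc m) (suc t) = no-second-mark m t

    Checked : Stream I → ℕ → Set
    Checked w L =
      (∀ t → t < L → T (notMarkedAgain (memory (seen mark) w t) (w t))) × T (memory (seen mark) w L)

    checked⇒singleton : ∀ w L → Checked w L → ∃[ m ] m < L × SingletonBelow L (mark ∘ w) m
    checked⇒singleton w L (ok , marked) with oneMarkBelow w L ok
    ... | inj₁ (mem , _) = ⊥-elim (subst T mem marked)
    ... | inj₂ (m , m<L , _ , marks) = m , m<L , marks

    singleton⇒checked : ∀ w L → ∃[ m ] m < L × SingletonBelow L (mark ∘ w) m → Checked w L
    singleton⇒checked w L (m , m<L , marks) =
      (λ t t<L → subst (λ b → T (not b))
                       (sym (cong₂ _∧_ (memory-seen mark w marks t (<⇒≤ t<L)) (marks t t<L)))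
                       (no-second-mark m t)) ,
      subst T (sym (memory-seen mark w marks L ≤-refl)) (<⇒<ᵇ m<L)

  accepts-exactlyOneMark : ∀ w L → T (accepts exactlyOneMark w L) ⇔
    (∃[ m ] m < L × SingletonBelow L (mark ∘ w) m)
  accepts-exactlyOneMark w L = ⇔.trans (accepts-monitor (seen mark) notMarkedAgain id w L)
                                       (mk⇔ (checked⇒singleton w L) (singleton⇒checked w L))

-- Projection of a guessed bit: the subset construction

splice : Stream Bool → ℕ → Bool → Stream Bool
splice g t b u = if u <ᵇ t then g u else b

splice-below : ∀ g {t} b {u} → u < t → splice g t b u ≡ g u
splice-below g {t} b {u} u<t = cong (λ c → if c then g u else b) (to T-≡ (<⇒<ᵇ u<t))

splice-at : ∀ g t b → splice g t b t ≡ b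
splice-at g t b = cong (λ c → if c then g t else b) (to T-not-≡ (from (T-not-<ᵇ {t} {t}) ≤-refl))

guessed : ∀ {I J : Set} → (I → Bool → J) → Stream I → Stream Bool → Stream J
guessed h w g t = h (w t) (g t)

module Projection {I J : Set} (D : DFA J) (h : I → Bool → J) where
  open DFA D

  members : Fin (2 ^ size) → Fin size → Bool
  members S = Inverse.to 2↔Bool ∘ finToFun S

  subset : (Fin size → Bool) → Fin (2 ^ size)
  subset f = funToFin (Inverse.from 2↔Bool ∘ f)

  members-subset : ∀ f i → members (subset f) i ≡ f i
  members-subset f i =
    trans (cong (Inverse.to 2↔Bool) (finToFun-funToFin _ i)) (Inverse.strictlyInverseˡ 2↔Bool (f i))

  Successor : I → Fin size → Fin size → Set
  Successor a i j = ∃[ b ] step i (h a b) ≡ j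

  successor? : ∀ a i j → Dec (Successor a i j)
  successor? a i j = map′ (λ { (inj₁ e) → false , e ; (inj₂ e) → true , e })
                          (λ { (false , e) → inj₁ e ; (true , e) → inj₂ e })
                          (step i (h a false) ≟ j ⊎-dec step i (h a true) ≟ j)

  project : DFA I
  project = record
    { size = 2 ^ size
    ; start = subset (λ j → does (start ≟ j))
    ; step = λ S a → subset (λ j → does (any? (λ i → T? (members S i) ×-dec successor? a i j)))
    ; accepting = λ S → does (any? (λ i → T? (members S i) ×-dec T? (accepting i)))
    }

  data Reachable (w : Stream I) : ℕ → Fin size → Set where
    start-reachable : Reachable w zero start
    step-reachable  : ∀ {t i j} → Reachable w t i → Successor (w t) i j → Reachable w (suc t) j

  members-run : ∀ w t j → T (members (run project w t) j) ⇔ Reachable w t j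
  members-run w zero j = ⇔.trans (≡⇒T⇔ (members-subset _ j)) (⇔.trans (T-does (start ≟ j))
    (mk⇔ (λ { refl → start-reachable }) (λ { start-reachable → refl })))
  members-run w (suc t) j =
    ⇔.trans (≡⇒T⇔ (members-subset _ j)) (⇔.trans (T-does (any? _))
      (⇔.trans (∃-⇔ (λ i → members-run w t i ×-⇔ ⇔.refl))
        (mk⇔ (λ (i , r , s) → step-reachable r s) (λ { (step-reachable r s) → _ , r , s }))))

  run-reachable : ∀ w g t → Reachable w t (run D (guessed h w g) t)
  run-reachable w g zero = start-reachable
  run-reachable w g (suc t) = step-reachable (run-reachable w g t) (g t , refl)

  reachable-run : ∀ {w t j} → Reachable w t j → ∃[ g ] run D (guessed h w g) t ≡ j
  reachable-run start-reachable = (λ _ → false) , refl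
  reachable-run {w} (step-reachable {t} r (b , e)) with reachable-run r
  ... | g , run≡i = splice g t b , trans (cong₂ step
    (trans (runFrom-prefix step start t (λ u u<t → cong (h (w u)) (splice-below g b u<t))) run≡i)
    (cong (h (w t)) (splice-at g t b))) e

  accepts-project : ∀ w L → T (accepts project w L) ⇔ (∃[ g ] T (accepts D (guessed h w g) L))
  accepts-project w L = ⇔.trans (T-does (any? _)) (mk⇔
    (λ (i , i∈S , a) → let g , run≡i = reachable-run (to (members-run w L i) i∈S)
                       in g , subst (T ∘ accepting) (sym run≡i) a)
    (λ (g , a) → run D (guessed h w g) L , from (members-run w L _) (run-reachable w g L) , a))

open Projection using (project; accepts-project)

Sat : ∀ {n q} → Formula n q → (Fin n → ℕ) → (Fin q → Stream Bool) → Set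
Sat (x ≐ y) k σ = k x ≡ k y
Sat (x ≼ y) k σ = k x ≤ k y
Sat (𝐒 x y) k σ = k y ≡ suc (k x)
Sat (𝐙 x) k σ = k x ≡ 0
Sat (x ∈ᶠ X) k σ = σ X (k x) ≡ true
Sat 𝐓 k σ = ⊤
Sat 𝐅 k σ = ⊥
Sat (φ ∧ᶠ ψ) k σ = Sat φ k σ × Sat ψ k σ
Sat (¬ᶠ φ) k σ = ¬ Sat φ k σ
Sat (∃ᵢ φ) k σ = ∃[ m ] Sat φ (m ∷ᵥ k) σ
Sat (∃ₛ φ) k σ = ∃[ β ] Sat φ k (β ∷ᵥ σ)

SatBelow : ∀ {n q} → ℕ → Formula n q → (Fin n → ℕ) → (Fin q → Stream Bool) → Set
SatBelow L (x ≐ y) k σ = k x ≡ k y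
SatBelow L (x ≼ y) k σ = k x ≤ k y
SatBelow L (𝐒 x y) k σ = k y ≡ suc (k x)
SatBelow L (𝐙 x) k σ = k x ≡ 0
SatBelow L (x ∈ᶠ X) k σ = σ X (k x) ≡ true
SatBelow L 𝐓 k σ = ⊤
SatBelow L 𝐅 k σ = ⊥
SatBelow L (φ ∧ᶠ ψ) k σ = SatBelow L φ k σ × SatBelow L ψ k σ
SatBelow L (¬ᶠ φ) k σ = ¬ SatBelow L φ k σ
SatBelow L (∃ᵢ φ) k σ = ∃[ m ] m < L × SatBelow L φ (m ∷ᵥ k) σ
SatBelow L (∃ₛ φ) k σ = ∃[ β ] SatBelow L φ k (β ∷ᵥ σ)

-- Automata for bounded formulae

Letter : ℕ → ℕ → Set
Letter n q = (Fin n → Bool) × (Fin q → Bool)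

EncodesBelow : ∀ {n q} → ℕ → (Fin n → ℕ) → (Fin q → Stream Bool) → Stream (Letter n q) → Set
EncodesBelow L k σ w =
  ∀ t → t < L → (∀ i → proj₁ (w t) i ≡ singleton (k i) t) × (∀ X → proj₂ (w t) X ≡ σ X t)

Recognises : ∀ {n q} → DFA (Letter n q) → Formula n q → Set
Recognises D φ =
  ∀ {L k σ w} → (∀ i → k i < L) → EncodesBelow L k σ w → T (accepts D w L) ⇔ SatBelow L φ k σ

-- Every atom is a test P of the letter at the position of one individual
-- variable x, given one bit of memory about the letters before it.
module _ {n q} (x : Fin n) (update P : Bool → Letter n q → Bool) where
  private
    checkAtX : Bool → Letter n q → Bool
    checkAtX m a = not (proj₁ a x) ∨ P m a

  atPosition : DFA (Letter n q)
  atPosition = monitor update checkAtX (const true)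

  accepts-atPosition : ∀ {L k σ w} → k x < L → EncodesBelow L k σ w →
    T (accepts atPosition w L) ⇔ T (P (memory update w (k x)) (w (k x)))
  accepts-atPosition {L} {k} {σ} {w} kx<L enc =
    ⇔.trans (accepts-monitor update checkAtX (const true) w L)
            (mk⇔ (λ (ok , _) → atX (ok (k x) kx<L)) (λ p → elsewhere p , tt))
    where
    bitX : ∀ t → t < L → proj₁ (w t) x ≡ singleton (k x) t
    bitX t t<L = proj₁ (enc t t<L) x
    markedAtX : ∀ t → t ≡ k x → t < L → proj₁ (w t) x ≡ true
    markedAtX t refl t<L = trans (bitX t t<L) (singleton-refl t)
    atX : T (checkAtX (memory update w (k x)) (w (k x))) → T (P (memory update w (k x)) (w (k x)))
    atX = subst (λ b → T (not b ∨ P (memory update w (k x)) (w (k x)))) (markedAtX (k x) refl kx<L)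
    elsewhere : T (P (memory update w (k x)) (w (k x))) →
      ∀ t → t < L → T (checkAtX (memory update w t) (w t))
    elsewhere p t t<L with t ≟ℕ k x
    ... | yes refl = subst (λ b → T (not b ∨ P (memory update w t) (w t))) (sym (markedAtX t refl t<L)) p
    ... | no t≢kx rewrite bitX t t<L | singleton-≢ t≢kx = tt

extendI : ∀ {n q} → Letter n q → Bool → Letter (suc n) q
extendI a b = (b ∷ᵥ proj₁ a) , proj₂ a

extendS : ∀ {n q} → Letter n q → Bool → Letter n (suc q)
extendS a b = proj₁ a , (b ∷ᵥ proj₂ a)

bitOfZero : ∀ {n q} → Letter (suc n) q → Bool
bitOfZero a = proj₁ a zero

automaton : ∀ {n q} → Formula n q → DFA (Letter n q)
automaton (x ≐ y) = atPosition x (λ _ _ → false) (λ _ a → proj₁ a y)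
automaton (x ≼ y) = atPosition x (seen (λ a → proj₁ a y)) (λ m _ → not m)
automaton (𝐒 x y) = atPosition y (λ _ a → proj₁ a x) (λ m _ → m)
automaton (𝐙 x) = atPosition x (λ _ _ → true) (λ m _ → not m)
automaton (x ∈ᶠ X) = atPosition x (λ _ _ → false) (λ _ a → proj₂ a X)
automaton 𝐓 = constant true
automaton 𝐅 = constant false
automaton (φ ∧ᶠ ψ) = automaton φ ⊗ automaton ψ
automaton (¬ᶠ φ) = complement (automaton φ)
automaton (∃ᵢ φ) = project (automaton φ ⊗ exactlyOneMark bitOfZero) extendI
automaton (∃ₛ φ) = project (automaton φ) extendS

module _ {n q} {L} {k : Fin n → ℕ} {σ : Fin q → Stream Bool} {w : Stream (Letter n q)}
         (kL : ∀ i → k i < L) (enc : EncodesBelow L k σ w) where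

  encodes-extendS : ∀ g → EncodesBelow L k (g ∷ᵥ σ) (guessed extendS w g)
  encodes-extendS g t t<L = proj₁ (enc t t<L) , λ { zero → refl ; (suc X) → proj₂ (enc t t<L) X }

  encodes-extendI : ∀ {g m} → SingletonBelow L g m → EncodesBelow L (m ∷ᵥ k) σ (guessed extendI w g)
  encodes-extendI marks t t<L =
    (λ { zero → marks t t<L ; (suc i) → proj₁ (enc t t<L) i }) , proj₂ (enc t t<L)

  extend-< : ∀ {m} → m < L → ∀ i → (m ∷ᵥ k) i < L
  extend-< m<L zero = m<L
  extend-< m<L (suc i) = kL i

recognises-≐ : ∀ {n q} (x y : Fin n) → Recognises {n} {q} (automaton (x ≐ y)) (x ≐ y)
recognises-≐ x y kL enc =
  ⇔.trans (accepts-atPosition x (λ _ _ → false) (λ _ a → proj₁ a y) (kL x) enc)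
          (⇔.trans (≡⇒T⇔ (proj₁ (enc _ (kL x)) y)) T-singleton)

recognises-≼ : ∀ {n q} (x y : Fin n) → Recognises {n} {q} (automaton (x ≼ y)) (x ≼ y)
recognises-≼ x y {w = w} kL enc =
  ⇔.trans (accepts-atPosition x (seen (λ a → proj₁ a y)) (λ m _ → not m) (kL x) enc)
          (⇔.trans (≡⇒T⇔ (cong not (memory-seen (λ a → proj₁ a y) w seenY _ (<⇒≤ (kL x))))) T-not-<ᵇ)
  where
  seenY : SingletonBelow _ (λ t → proj₁ (w t) y) _
  seenY t t<L = proj₁ (enc t t<L) y

recognises-𝐒 : ∀ {n q} (x y : Fin n) → Recognises {n} {q} (automaton (𝐒 x y)) (𝐒 x y)
recognises-𝐒 x y {L} {k} {w = w} kL enc =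
  ⇔.trans (accepts-atPosition y (λ _ a → proj₁ a x) (λ m _ → m) (kL y) enc) (previous (k y) (kL y))
  where
  previous : ∀ t → t < L → T (memory (λ _ a → proj₁ a x) w t) ⇔ t ≡ suc (k x)
  previous zero _ = mk⇔ (λ ()) (λ ())
  previous (suc t) t<L =
    ⇔.trans (≡⇒T⇔ (proj₁ (enc t (<⇒≤ t<L)) x)) (⇔.trans T-singleton (mk⇔ (cong suc) suc-injective))

recognises-𝐙 : ∀ {n q} (x : Fin n) → Recognises {n} {q} (automaton (𝐙 x)) (𝐙 x)
recognises-𝐙 x {k = k} {w = w} kL enc =
  ⇔.trans (accepts-atPosition x (λ _ _ → true) (λ m _ → not m) (kL x) enc) (initial (k x))
  where
  initial : ∀ t → T (not (memory (λ _ _ → true) w t)) ⇔ t ≡ 0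
  initial zero = mk⇔ (const refl) (const tt)
  initial (suc t) = mk⇔ (λ ()) (λ ())

recognises-∈ : ∀ {n q} (x : Fin n) (X : Fin q) → Recognises (automaton (x ∈ᶠ X)) (x ∈ᶠ X)
recognises-∈ x X kL enc =
  ⇔.trans (accepts-atPosition x (λ _ _ → false) (λ _ a → proj₂ a X) (kL x) enc)
          (⇔.trans (≡⇒T⇔ (proj₂ (enc _ (kL x)) X)) T-≡)

recognises-∃ᵢ : ∀ {n q} {D : DFA (Letter (suc n) q)} {φ} → Recognises D φ →
  Recognises (project (D ⊗ exactlyOneMark bitOfZero) extendI) (∃ᵢ φ)
recognises-∃ᵢ {D = D} recognises {L} {k} {σ} {w} kL enc =
  ⇔.trans (accepts-project (D ⊗ E) extendI w L) (mk⇔ sound complete)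
  where
  E : DFA (Letter (suc _) _)
  E = exactlyOneMark bitOfZero
  sound : ∃[ g ] T (accepts (D ⊗ E) (guessed extendI w g) L) → SatBelow L (∃ᵢ _) k σ
  sound (g , a) with to T-∧ (subst T (accepts-⊗ D E _ L) a)
  ... | inD , inE with to (accepts-exactlyOneMark bitOfZero _ L) inE
  ... | m , m<L , marks =
    m , m<L , to (recognises (extend-< kL enc m<L) (encodes-extendI kL enc marks)) inD
  complete : SatBelow L (∃ᵢ _) k σ → ∃[ g ] T (accepts (D ⊗ E) (guessed extendI w g) L)
  complete (m , m<L , sat) = singleton m , subst T (sym (accepts-⊗ D E _ L))
    (from T-∧ (from (recognises (extend-< kL enc m<L) (encodes-extendI kL enc (λ _ _ → refl))) sat ,
               from (accepts-exactlyOneMark bitOfZero _ L) (m , m<L , λ _ _ → refl)))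

automaton-recognises : ∀ {n q} (φ : Formula n q) → Recognises (automaton φ) φ
automaton-recognises (x ≐ y) = recognises-≐ x y
automaton-recognises (x ≼ y) = recognises-≼ x y
automaton-recognises (𝐒 x y) = recognises-𝐒 x y
automaton-recognises (𝐙 x) = recognises-𝐙 x
automaton-recognises (x ∈ᶠ X) = recognises-∈ x X
automaton-recognises 𝐓 _ _ = mk⇔ (const tt) (const tt)
automaton-recognises 𝐅 _ _ = mk⇔ (λ ()) (λ ())
automaton-recognises (φ ∧ᶠ ψ) {L} {w = w} kL enc =
  ⇔.trans (≡⇒T⇔ (accepts-⊗ (automaton φ) (automaton ψ) w L))
          (⇔.trans T-∧ (automaton-recognises φ kL enc ×-⇔ automaton-recognises ψ kL enc))
automaton-recognises (¬ᶠ φ) kL enc = ⇔.trans T-not (¬-cong-⇔ (automaton-recognises φ kL enc))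
automaton-recognises (∃ᵢ φ) = recognises-∃ᵢ {D = automaton φ} (automaton-recognises φ)
automaton-recognises (∃ₛ φ) {L} {w = w} kL enc =
  ⇔.trans (accepts-project (automaton φ) extendS w L)
          (∃-⇔ λ g → automaton-recognises φ kL (encodes-extendS kL enc g))

accepts⇒sat : ∀ {n q} (φ : Formula n q) {k σ R} → Accepts φ k σ R → Sat φ k σ
sat⇒accepts : ∀ {n q} (φ : Formula n q) {k σ} → Sat φ k σ → ∃[ R ] Accepts φ k σ R

accepts⇒sat (x ≐ y) a = a
accepts⇒sat (x ≼ y) a = a
accepts⇒sat (𝐒 x y) a = a
accepts⇒sat (𝐙 x) a = a
accepts⇒sat (x ∈ᶠ X) a = a
accepts⇒sat 𝐓 a = a
accepts⇒sat 𝐅 a = a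
accepts⇒sat (φ ∧ᶠ ψ) (a , b) = accepts⇒sat φ a , accepts⇒sat ψ b
accepts⇒sat (¬ᶠ φ) a s = a (sat⇒accepts φ s)
accepts⇒sat (∃ᵢ φ) (m , _ , a) = m , accepts⇒sat φ a
accepts⇒sat (∃ₛ φ) a = _ , accepts⇒sat φ a

sat⇒accepts (x ≐ y) s = _ , s
sat⇒accepts (x ≼ y) s = _ , s
sat⇒accepts (𝐒 x y) s = _ , s
sat⇒accepts (𝐙 x) s = _ , s
sat⇒accepts (x ∈ᶠ X) s = _ , s
sat⇒accepts 𝐓 s = _ , s
sat⇒accepts (φ ∧ᶠ ψ) (s , s′) with sat⇒accepts φ s | sat⇒accepts ψ s′
... | R , a | R′ , a′ = (λ t → R t , R′ t) , a , a′
sat⇒accepts (¬ᶠ φ) s = _ , λ (R , a) → s (accepts⇒sat φ a)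
sat⇒accepts (∃ᵢ φ) (m , s) with sat⇒accepts φ s
... | R , a = (λ t → singleton m t , tt , R t) , m , (λ _ → refl) , a
sat⇒accepts (∃ₛ φ) (β , s) with sat⇒accepts φ s
... | R , a = (λ t → β t , R t) , a

sat-renI : ∀ {m n q} (ρ : Fin m → Fin n) (θ : Formula m q) {k k′ σ} →
  (∀ i → k′ i ≡ k (ρ i)) → Sat (renI ρ θ) k σ ⇔ Sat θ k′ σ
sat-renI ρ (x ≐ y) h rewrite h x | h y = ⇔.refl
sat-renI ρ (x ≼ y) h rewrite h x | h y = ⇔.refl
sat-renI ρ (𝐒 x y) h rewrite h x | h y = ⇔.refl
sat-renI ρ (𝐙 x) h rewrite h x = ⇔.refl
sat-renI ρ (x ∈ᶠ X) h rewrite h x = ⇔.refl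
sat-renI ρ 𝐓 h = ⇔.refl
sat-renI ρ 𝐅 h = ⇔.refl
sat-renI ρ (φ ∧ᶠ ψ) h = sat-renI ρ φ h ×-⇔ sat-renI ρ ψ h
sat-renI ρ (¬ᶠ φ) h = ¬-cong-⇔ (sat-renI ρ φ h)
sat-renI ρ (∃ᵢ φ) h = ∃-⇔ λ m → sat-renI (liftᵣ ρ) φ λ { zero → refl ; (suc i) → h i }
sat-renI ρ (∃ₛ φ) h = ∃-⇔ λ β → sat-renI ρ φ h

sat-renS : ∀ {n q r} (ρ : Fin q → Fin r) (θ : Formula n q) {k σ σ′} →
  (∀ X t → σ′ X t ≡ σ (ρ X) t) → Sat (renS ρ θ) k σ ⇔ Sat θ k σ′
sat-renS ρ (x ≐ y) h = ⇔.refl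
sat-renS ρ (x ≼ y) h = ⇔.refl
sat-renS ρ (𝐒 x y) h = ⇔.refl
sat-renS ρ (𝐙 x) h = ⇔.refl
sat-renS ρ (x ∈ᶠ X) {k} h rewrite h X (k x) = ⇔.refl
sat-renS ρ 𝐓 h = ⇔.refl
sat-renS ρ 𝐅 h = ⇔.refl
sat-renS ρ (φ ∧ᶠ ψ) h = sat-renS ρ φ h ×-⇔ sat-renS ρ ψ h
sat-renS ρ (¬ᶠ φ) h = ¬-cong-⇔ (sat-renS ρ φ h)
sat-renS ρ (∃ᵢ φ) h = ∃-⇔ λ m → sat-renS ρ φ h
sat-renS ρ (∃ₛ φ) h = ∃-⇔ λ β → sat-renS (liftᵣ ρ) φ λ { zero t → refl ; (suc X) t → h X t }

sat-rel≤ : ∀ {n q} (y : Fin n) (χ : Formula n q) {k σ} → Sat (rel≤ y χ) k σ ⇔ SatBelow (suc (k y)) χ k σ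
sat-rel≤ y (x ≐ z) = ⇔.refl
sat-rel≤ y (x ≼ z) = ⇔.refl
sat-rel≤ y (𝐒 x z) = ⇔.refl
sat-rel≤ y (𝐙 x) = ⇔.refl
sat-rel≤ y (x ∈ᶠ X) = ⇔.refl
sat-rel≤ y 𝐓 = ⇔.refl
sat-rel≤ y 𝐅 = ⇔.refl
sat-rel≤ y (φ ∧ᶠ ψ) = sat-rel≤ y φ ×-⇔ sat-rel≤ y ψ
sat-rel≤ y (¬ᶠ φ) = ¬-cong-⇔ (sat-rel≤ y φ)
sat-rel≤ y (∃ᵢ χ) = ∃-⇔ λ m → mk⇔ s≤s s≤s⁻¹ ×-⇔ sat-rel≤ (suc y) χ
sat-rel≤ y (∃ₛ χ) = ∃-⇔ λ β → sat-rel≤ y χ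

Realises : ∀ {r} → Formula 1 r → (Fin r → Stream Bool) → Maybe (Fin r) → Stream Bool → Set
Realises θ σ (just j) β = ∀ t → β t ≡ σ j t
Realises θ σ nothing β = ∀ t → β t ≡ true ⇔ Sat θ (λ _ → t) σ

SubstEnv : ∀ {q r} → (Fin q → Maybe (Fin r)) → Formula 1 r →
  (Fin r → Stream Bool) → (Fin q → Stream Bool) → Set
SubstEnv ρ θ σ σ′ = ∀ X → Realises θ σ (ρ X) (σ′ X)

module _ {q r} {ρ : Fin q → Maybe (Fin r)} {θ : Formula 1 r}
         {σ : Fin r → Stream Bool} {σ′ : Fin q → Stream Bool} where

  substEnv-lift : SubstEnv ρ θ σ σ′ → ∀ β → SubstEnv (liftₘ ρ) (renS suc θ) (β ∷ᵥ σ) (β ∷ᵥ σ′)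
  substEnv-lift env β zero t = refl
  substEnv-lift env β (suc X) with ρ X | env X
  ... | just j | e = e
  ... | nothing | e = λ t → ⇔.trans (e t) (⇔.sym (sat-renS suc θ (λ _ _ → refl)))

sat-substY : ∀ {n q r} {ρ : Fin q → Maybe (Fin r)} {θ σ σ′} (ψ : Formula n q) {k} →
  SubstEnv ρ θ σ σ′ → Sat (substY ρ θ ψ) k σ ⇔ Sat ψ k σ′
sat-substY (x ≐ y) env = ⇔.refl
sat-substY (x ≼ y) env = ⇔.refl
sat-substY (𝐒 x y) env = ⇔.refl
sat-substY (𝐙 x) env = ⇔.refl
sat-substY {ρ = ρ} {θ} (x ∈ᶠ X) {k} env with ρ X | env X
... | just j | e rewrite e (k x) = ⇔.refl
... | nothing | e = ⇔.trans (sat-renI (λ _ → x) θ (λ _ → refl)) (⇔.sym (e (k x)))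
sat-substY 𝐓 env = ⇔.refl
sat-substY 𝐅 env = ⇔.refl
sat-substY (φ ∧ᶠ ψ) env = sat-substY φ env ×-⇔ sat-substY ψ env
sat-substY (¬ᶠ φ) env = ¬-cong-⇔ (sat-substY φ env)
sat-substY (∃ᵢ φ) env = ∃-⇔ λ m → sat-substY φ env
sat-substY (∃ₛ φ) env = ∃-⇔ λ β → sat-substY φ (substEnv-lift env β)

translateMoves : ∀ {n q r} (ρ : Fin q → Maybe (Fin r)) θ (ψ : Formula n q) → M (substY ρ θ ψ) → M ψ
translateMoves ρ θ (x ≐ y) _ = tt
translateMoves ρ θ (x ≼ y) _ = tt
translateMoves ρ θ (𝐒 x y) _ = tt
translateMoves ρ θ (𝐙 x) _ = tt
translateMoves ρ θ (x ∈ᶠ X) _ = tt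
translateMoves ρ θ 𝐓 _ = tt
translateMoves ρ θ 𝐅 _ = tt
translateMoves ρ θ (φ ∧ᶠ ψ) (r , r′) = translateMoves ρ θ φ r , translateMoves ρ θ ψ r′
translateMoves ρ θ (¬ᶠ φ) _ = tt
translateMoves ρ θ (∃ᵢ φ) (b , _ , r) = b , tt , translateMoves ρ θ φ r
translateMoves ρ θ (∃ₛ φ) (b , r) = b , translateMoves (liftₘ ρ) (renS suc θ) φ r

accepts-substY : ∀ {n q r} {ρ : Fin q → Maybe (Fin r)} {θ σ σ′} (ψ : Formula n q) {k R} →
  SubstEnv ρ θ σ σ′ → Accepts (substY ρ θ ψ) k σ R → Accepts ψ k σ′ (translateMoves ρ θ ψ ∘ R)
accepts-substY (x ≐ y) env a = a
accepts-substY (x ≼ y) env a = a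
accepts-substY (𝐒 x y) env a = a
accepts-substY (𝐙 x) env a = a
accepts-substY {ρ = ρ} {θ} (x ∈ᶠ X) {k} env a with ρ X | env X
... | just j | e rewrite e (k x) = a
... | nothing | e =
  from (e (k x)) (to (sat-renI (λ _ → x) θ (λ _ → refl)) (accepts⇒sat (renI (λ _ → x) θ) a))
accepts-substY 𝐓 env a = a
accepts-substY 𝐅 env a = a
accepts-substY (φ ∧ᶠ ψ) env (a , a′) = accepts-substY φ env a , accepts-substY ψ env a′
accepts-substY {ρ = ρ} {θ} (¬ᶠ φ) env a (_ , a′) =
  a (sat⇒accepts (substY ρ θ φ) (from (sat-substY φ env) (accepts⇒sat φ a′)))
accepts-substY (∃ᵢ φ) env (m , isSingleton , a) = m , isSingleton , accepts-substY φ env a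
accepts-substY (∃ₛ φ) env a = accepts-substY φ (substEnv-lift env _) a

-- The Mealy machine realising the substitution

withMark : ∀ {p} → (Fin p → Bool) → Bool → Letter 1 p
withMark bits b = (λ _ → b) , bits

module _ {ℓ p} (ψ : Formula ℓ (suc p)) (χ : Formula 1 p) where
  open DFA (automaton χ)

  -- The machine runs the automaton of χ on σ⃗ with y unmarked; at time t it
  -- reads the current letter once more with y marked, which decides φ̂[t].
  substitutionMachine : Mealy (Input ℓ p (M (ψ [ rel≤ zero χ /Y]))) (M (∃ₛ ψ))
  substitutionMachine = record
    { states = size
    ; init = start
    ; δ = λ s (_ , bits , _ , _) → step s (withMark bits false)
    ; out = λ s (_ , bits , _ , r) →
        accepting (step s (withMark bits true)) , translateMoves ρY (rel≤ zero χ) ψ r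
    }

  module _ (k : Fin ℓ → ℕ) (σ : Fin p → Stream Bool) (R : Stream (M (ψ [ rel≤ zero χ /Y]))) where
    private
      input : Stream (Input ℓ p (M (ψ [ rel≤ zero χ /Y])))
      input = inputStream k σ R

      markedAt : ℕ → Stream (Letter 1 p)
      markedAt t u = withMark (λ j → σ j u) (singleton t u)

    witness : Stream Bool
    witness t = proj₁ (runMealy substitutionMachine input t)

    state-unmarked : ∀ t →
      stateAt substitutionMachine input t ≡ run (automaton χ) (λ u → withMark (λ j → σ j u) false) t
    state-unmarked zero = refl
    state-unmarked (suc t) = cong (λ s → step s _) (state-unmarked t)

    state-markedAt : ∀ t → stateAt substitutionMachine input t ≡ run (automaton χ) (markedAt t) t
    state-markedAt t = trans (state-unmarked t)
      (runFrom-prefix step start t λ u u<t → cong (withMark _) (sym (singleton-≢ (<⇒≢ u<t))))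

    witness-accepts : ∀ t → witness t ≡ accepts (automaton χ) (markedAt t) (suc t)
    witness-accepts t =
      cong₂ (λ s b → accepting (step s (withMark (λ j → σ j t) b)))
            (state-markedAt t) (sym (singleton-refl t))

    witness-sat : ∀ t → witness t ≡ true ⇔ Sat (rel≤ zero χ) (λ _ → t) σ
    witness-sat t =
      ⇔.trans (⇔.sym T-≡) (⇔.trans (≡⇒T⇔ (witness-accepts t))
        (⇔.trans (automaton-recognises χ (λ _ → ≤-refl) (λ u _ → (λ _ → refl) , (λ _ → refl)))
                 (⇔.sym (sat-rel≤ zero χ))))

    substEnv : SubstEnv ρY (rel≤ zero χ) σ (witness ∷ᵥ σ)
    substEnv zero = witness-sat
    substEnv (suc X) t = refl

lemma5p14 : (ℓ p : ℕ) (ψ : Formula ℓ (suc p)) (φ̂ : Formula 1 p) → UniformlyBounded φ̂ →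
    Σ (Mealy (Input ℓ p (M (ψ [ φ̂ /Y]))) (M (∃ₛ ψ))) (λ F →
      (k : Fin ℓ → ℕ) (σ : Fin p → Stream Bool) (R : Stream (M (ψ [ φ̂ /Y]))) →
      Accepts (ψ [ φ̂ /Y]) k σ R →
      Accepts (∃ₛ ψ) k σ (runMealy F (inputStream k σ R)))
lemma5p14 ℓ p ψ .(rel≤ zero χ) (χ , refl) =
  substitutionMachine ψ χ , λ k σ R accepted → accepts-substY ψ (substEnv ψ χ k σ R) accepted
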